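{- Let $G_0=K_1\vee\Theta(2,2,2)$. Then $P_{DP}(G_0,4)\leq 104< P(G_0,4)=120$.
   Context: All graphs are finite and simple. $\Theta(2,2,2)$ is the graph consisting of two end vertices joined by three internally disjoint paths each of length two (isomorphic to $K_{2,3}$), and $K_1\vee\Theta(2,2,2)$ is the join of a single vertex with it (a new vertex adjacent to all five vertices). $P(G,m)$ denotes the chromatic polynomial (number of proper $m$-colorings). A cover of a graph $G$ is a pair $\mathcal{H}=(L,H)$ where $H$ is a graph and $L:V(G)\to\mathcal{P}(V(H))$ satisfies: (1) $\{L(u):u\in V(G)\}$ is a partition of $V(H)$ into $|V(G)|$ parts; (2) $H[L(u)]$ is complete for each $u$; (3) if $E_H(L(u),L(v))$ is nonempty then $u=v$ or $uv\in E(G)$; (4) if $uv\in E(G)$ then $E_H(L(u),L(v))$ is a (possibly empty) matching. $\mathcal{H}$ is $m$-fold if $|L(u)|=m$ for all $u$. An $\mathcal{H}$-coloring of $G$ is an independent set of $H$ of size $|V(G)|$. The DP color function $P_{DP}(G,m)$ is the minimum number of $\mathcal{H}$-colorings of $G$ over all $m$-fold covers $\mathcal{H}$ of $G$. -}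

module Defs where

open import Data.Nat using (ℕ; zero; suc)
open import Data.Bool using (Bool; true; false; not; _∧_; _∨_; if_then_else_)
open import Data.Fin using (Fin; toℕ; _≟_)
open import Data.Fin.Base using () renaming (zero to fz; suc to fs)
open import Data.List using (List; []; _∷_; [_]; map; concatMap; filter; length; allFin; foldr)
open import Data.Product using (_×_; _,_)
open import Data.Vec.Functional using () renaming (_∷_ to _∷ᶠ_)
open import Relation.Nullary using (¬_; does)
open import Relation.Binary.PropositionalEquality using (_≡_; _≢_)
open import Relation.Nullary.Decidable using (T?)
open import Data.Bool using (T)

record Graph (n : ℕ) : Set where
  field
    adj    : Fin n → Fin n → Bool
    sym    : ∀ u v → adj u v ≡ adj v u
    irrefl : ∀ u → adj u u ≡ false
open Graph public

allB : ∀ {A : Set} → (A → Bool) → List A → Bool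
allB p = foldr (λ x b → p x ∧ b) true

_==_ : ∀ {m} → Fin m → Fin m → Bool
x == y = does (x ≟ y)

funs : ∀ n m → List (Fin n → Fin m)
funs zero    m = [ (λ ()) ]
funs (suc n) m = concatMap (λ f → map (λ c → c ∷ᶠ f) (allFin m)) (funs n m)

isProper : ∀ {n m} → Graph n → (Fin n → Fin m) → Bool
isProper {n} G f = allB (λ u → allB (λ v → not (adj G u v ∧ (f u == f v))) (allFin n)) (allFin n)

P : ∀ {n} → Graph n → ℕ → ℕ
P {n} G m = length (filter (λ f → T? (isProper G f)) (funs n m))

-- Without loss of generality V(H) = Fin n × Fin m
-- with L(u) = {u} × Fin m (so condition (1) and m-foldness hold by construction).
record Cover {n : ℕ} (G : Graph n) (m : ℕ) : Set where
  field
    E        : Fin n × Fin m → Fin n × Fin m → Bool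
    E-sym    : ∀ x y → E x y ≡ E y x
    E-irrefl : ∀ x → E x x ≡ false
    clique   : ∀ u i j → i ≢ j → E (u , i) (u , j) ≡ true
    respects : ∀ u v i j → u ≢ v → E (u , i) (v , j) ≡ true → adj G u v ≡ true
    matching : ∀ u v i j k → u ≢ v →
               E (u , i) (v , j) ≡ true → E (u , i) (v , k) ≡ true → j ≡ k
open Cover public

-- Since each L(u) is a clique partitioning V(H), an independent set of size |V(G)|
-- is exactly a choice of one vertex (u , f u) from each L(u) with no H-edges among them.
isHColoring : ∀ {n m} {G : Graph n} → Cover G m → (Fin n → Fin m) → Bool
isHColoring {n} 𝓗 f = allB (λ u → allB (λ v → not (E 𝓗 (u , f u) (v , f v))) (allFin n)) (allFin n)

numHColorings : ∀ {n m} {G : Graph n} → Cover G m → ℕ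
numHColorings {n} {m} 𝓗 = length (filter (λ f → T? (isHColoring 𝓗 f)) (funs n m))

-- G0 = K1 ∨ Θ(2,2,2) on Fin 6:
-- vertex 0 = the K1 apex; vertices 1,2 = end vertices of Θ; vertices 3,4,5 = the
-- three internal vertices of the length-two paths.
adjℕ : ℕ → ℕ → Bool
adjℕ 0 0 = false
adjℕ 0 _ = true
adjℕ _ 0 = true
adjℕ 1 3 = true
adjℕ 1 4 = true
adjℕ 1 5 = true
adjℕ 2 3 = true
adjℕ 2 4 = true
adjℕ 2 5 = true
adjℕ 3 1 = true
adjℕ 4 1 = true
adjℕ 5 1 = true
adjℕ 3 2 = true
adjℕ 4 2 = true
adjℕ 5 2 = true
adjℕ _ _ = false

private
  allF6 : ∀ (p : Fin 6 → Set) → p fz → p (fs fz) → p (fs (fs fz)) → p (fs (fs (fs fz)))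
        → p (fs (fs (fs (fs fz)))) → p (fs (fs (fs (fs (fs fz))))) → ∀ x → p x
  allF6 p a b c d e f fz = a
  allF6 p a b c d e f (fs fz) = b
  allF6 p a b c d e f (fs (fs fz)) = c
  allF6 p a b c d e f (fs (fs (fs fz))) = d
  allF6 p a b c d e f (fs (fs (fs (fs fz)))) = e
  allF6 p a b c d e f (fs (fs (fs (fs (fs fz))))) = f

  open import Relation.Binary.PropositionalEquality using (refl)

  symG0 : ∀ (u v : Fin 6) → adjℕ (toℕ u) (toℕ v) ≡ adjℕ (toℕ v) (toℕ u)
  symG0 = allF6 _ (allF6 _ refl refl refl refl refl refl) (allF6 _ refl refl refl refl refl refl)
                  (allF6 _ refl refl refl refl refl refl) (allF6 _ refl refl refl refl refl refl)
                  (allF6 _ refl refl refl refl refl refl) (allF6 _ refl refl refl refl refl refl)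

  irrG0 : ∀ (u : Fin 6) → adjℕ (toℕ u) (toℕ u) ≡ false
  irrG0 = allF6 _ refl refl refl refl refl refl

G0 : Graph 6
G0 = record { adj = λ u v → adjℕ (toℕ u) (toℕ v) ; sym = symG0 ; irrefl = irrG0 }

{-# OPTIONS --safe #-}
module Submission where

-- The cover is the trivial one (identity matchings) twisted on the 4-cycle 1-4-2-5 of
-- Θ(2,2,2): the edge 14 carries the transposition (2 3) and the edge 25 carries (0 1).
-- The apex edges keep identity matchings, so giving the apex colour c just deletes c
-- from every other list; for each of the 4 choices of c the rest then has 26
-- colourings instead of P(Θ(2,2,2),3) = 30, whence 4·26 = 104 < 120 = 4·30 = P(G0,4).

open import Defs
open import Data.Nat using (ℕ; _≤_; _<_; _<?_)
open import Data.Nat.Properties using (≤-reflexive)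
open import Data.Bool using (Bool; true; false; not; _∧_; if_then_else_)
open import Data.Bool.Properties using (∧-conicalˡ; ∧-conicalʳ)
open import Data.Fin using (Fin; _≟_)
open import Data.Fin.Patterns using (0F; 1F; 2F; 3F; 4F; 5F)
open import Data.Fin.Permutation.Components using (transpose)
open import Data.Fin.Properties using (all?)
open import Data.Product using (Σ; _×_; _,_)
open import Data.Empty using (⊥-elim)
open import Function using (id)
open import Function.Bundles using (mk⇔)
open import Relation.Nullary using (yes; no)
open import Relation.Nullary.Decidable using (dec-true; dec-false; does-⇔; from-yes)
import Relation.Binary.PropositionalEquality as ≡
open ≡ using (_≡_; refl; _≢_; cong; cong₂; subst)

==⇒≡ : ∀ {k} {i j : Fin k} → (i == j) ≡ true → i ≡ j
==⇒≡ {i = i} {j} i==j with i ≟ j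
... | yes i≡j = i≡j
==⇒≡ () | no _

module PermutationCover {n m : ℕ} (G : Graph n) (σ : Fin n → Fin n → Fin m → Fin m)
                        (σ-inverse : ∀ u v i → σ v u (σ u v i) ≡ i) where

  edge : Fin n × Fin m → Fin n × Fin m → Bool
  edge (u , i) (v , j) = if u == v then not (i == j) else adj G u v ∧ (σ u v i == j)

  σ-transpose : ∀ {u v i j} → σ u v i ≡ j → σ v u j ≡ i
  σ-transpose {u} {v} {i} refl = σ-inverse u v i

  edge-sym : ∀ x y → edge x y ≡ edge y x
  edge-sym (u , i) (v , j) with u ≟ v | v ≟ u
  ... | yes _   | yes _   = cong not (does-⇔ (mk⇔ ≡.sym ≡.sym) (i ≟ j) (j ≟ i))
  ... | yes u≡v | no  v≢u = ⊥-elim (v≢u (≡.sym u≡v))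
  ... | no  u≢v | yes v≡u = ⊥-elim (u≢v (≡.sym v≡u))
  ... | no  _   | no  _   =
    cong₂ _∧_ (sym G u v) (does-⇔ (mk⇔ σ-transpose σ-transpose) (σ u v i ≟ j) (σ v u j ≟ i))

  edge-irrefl : ∀ x → edge x x ≡ false
  edge-irrefl (u , i) with u ≟ u
  ... | yes _   = cong not (dec-true (i ≟ i) refl)
  ... | no  u≢u = ⊥-elim (u≢u refl)

  edge-clique : ∀ u i j → i ≢ j → edge (u , i) (u , j) ≡ true
  edge-clique u i j i≢j with u ≟ u
  ... | yes _   = cong not (dec-false (i ≟ j) i≢j)
  ... | no  u≢u = ⊥-elim (u≢u refl)

  edge-respects : ∀ u v i j → u ≢ v → edge (u , i) (v , j) ≡ true → adj G u v ≡ true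
  edge-respects u v i j u≢v e with u ≟ v
  ... | yes u≡v = ⊥-elim (u≢v u≡v)
  ... | no  _   = ∧-conicalˡ _ _ e

  edge-matching : ∀ u v i j k → u ≢ v →
                  edge (u , i) (v , j) ≡ true → edge (u , i) (v , k) ≡ true → j ≡ k
  edge-matching u v i j k u≢v e₁ e₂ with u ≟ v
  ... | yes u≡v = ⊥-elim (u≢v u≡v)
  ... | no  _   = ≡.trans (≡.sym (matched-to j e₁)) (matched-to k e₂)
    where
    matched-to : ∀ l → adj G u v ∧ (σ u v i == l) ≡ true → σ u v i ≡ l
    matched-to l e = ==⇒≡ (∧-conicalʳ (adj G u v) _ e)

  cover : Cover G m
  cover = record
    { E = edge ; E-sym = edge-sym ; E-irrefl = edge-irrefl ; clique = edge-clique
    ; respects = edge-respects ; matching = edge-matching }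

twist : Fin 6 → Fin 6 → Fin 4 → Fin 4
twist 1F 4F = transpose 2F 3F
twist 4F 1F = transpose 2F 3F
twist 2F 5F = transpose 0F 1F
twist 5F 2F = transpose 0F 1F
twist _  _  = id

twist-inverse : ∀ u v i → twist v u (twist u v i) ≡ i
twist-inverse = from-yes (all? λ u → all? λ v → all? λ i → twist v u (twist u v i) ≟ i)

twistedCover : Cover G0 4
twistedCover = PermutationCover.cover G0 twist twist-inverse

twistedCover-colorings : numHColorings twistedCover ≡ 104
twistedCover-colorings = refl

P-G0-4 : P G0 4 ≡ 120
P-G0-4 = refl

lemma16 : (Σ (Cover G0 4) (λ 𝓗 → numHColorings 𝓗 ≤ 104)) × 104 < P G0 4 × P G0 4 ≡ 120
lemma16 =
    (twistedCover , ≤-reflexive twistedCover-colorings)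
  , subst (104 <_) (≡.sym P-G0-4) (from-yes (104 <? 120))
  , P-G0-4
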